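{- For every $r\in\mathbb{N}$ there exists a digraph $D$ with $\delta^+(D)\ge r$, $\delta^-(D)\ge r$ and $\mathrm{dtw}(D)=1$.
   Context: Digraphs are finite, have no loops and no parallel arcs (antiparallel arcs allowed). $\delta^+(D),\delta^-(D)$ denote minimum out- and in-degree. Directed tree-width (Johnson, Robertson, Seymour, Thomas): for $X\subseteq V(D)$, a set $Z\subseteq V(D)\setminus X$ is $X$-normal if there is no directed walk in $D-X$ whose first and last vertices lie in $Z$ and which contains a vertex not in $Z$. An arborescence is a directed tree $R$ with a root $r_0$ such that every vertex of $R$ is reachable from $r_0$ by a directed path. An arboreal decomposition of $D$ is a triple $(R,(X_e)_{e\in A(R)},(W_t)_{t\in V(R)})$ where $R$ is an arborescence, the $W_t$ are nonempty, pairwise disjoint sets with union $V(D)$, each $X_e\subseteq V(D)$, and for every arc $e=(s,t)$ of $R$ the set $\bigcup\{W_u: u \text{ reachable from } t \text{ in } R\}$ is $X_e$-normal. Its width is $\max_{t\in V(R)}\left|W_t\cup\bigcup_{e\text{ incident with }t}X_e\right|-1$. The directed tree-width $\mathrm{dtw}(D)$ is the minimum width of an arboreal decomposition of $D$. -}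

module Defs where

open import Data.Nat using (ℕ; zero; suc; _+_; _≤_; _⊔_; _∸_)
open import Data.Bool using (Bool; true; false)
open import Data.Fin using (Fin; zero; suc; inject₁; fromℕ)
open import Data.Fin.Subset using (Subset; _∈_; _∉_; _∪_; ⋃; ∣_∣; Nonempty)
open import Data.Vec using (tabulate)
open import Data.List using (List; []; _∷_; foldr; map; concatMap; allFin)
open import Data.Product using (Σ; ∃; _×_; _,_)
open import Data.Sum using (_⊎_)
open import Relation.Nullary using (¬_)
open import Relation.Binary.PropositionalEquality using (_≡_)
open import Relation.Binary.Construct.Closure.ReflexiveTransitive using (Star)
open import Function.Definitions using (Injective)

record Digraph : Set where
  field
    n        : ℕ
    arc      : Fin n → Fin n → Bool
    loopless : ∀ v → arc v v ≡ false

open Digraph public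

Arc : (D : Digraph) → Fin (n D) → Fin (n D) → Set
Arc D u v = arc D u v ≡ true

outdeg : (D : Digraph) → Fin (n D) → ℕ
outdeg D v = ∣ tabulate (λ w → arc D v w) ∣

indeg : (D : Digraph) → Fin (n D) → ℕ
indeg D v = ∣ tabulate (λ u → arc D u v) ∣

MinOutDeg≥ : Digraph → ℕ → Set
MinOutDeg≥ D r = ∀ v → r ≤ outdeg D v

MinInDeg≥ : Digraph → ℕ → Set
MinInDeg≥ D r = ∀ v → r ≤ indeg D v

record Walk (D : Digraph) : Set where
  field
    len   : ℕ
    vtx   : Fin (suc len) → Fin (n D)
    steps : ∀ (i : Fin len) → Arc D (vtx (inject₁ i)) (vtx (suc i))

open Walk public

first last : {D : Digraph} → Walk D → Fin (n D)
first w = vtx w zero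
last  w = vtx w (fromℕ (len w))

IsNormal : (D : Digraph) → Subset (n D) → (Fin (n D) → Set) → Set
IsNormal D X Z =
  (∀ v → Z v → v ∉ X) ×
  ¬ (Σ (Walk D) λ w →
       (∀ i → vtx w i ∉ X) ×
       Z (first w) × Z (last w) ×
       ∃ λ i → ¬ Z (vtx w i))

-- Arborescences: a directed tree (orientation of a tree: the underlying
-- multigraph has no cycle) with a root from which every vertex is
-- reachable by a directed path.

AdjU : (R : Digraph) → Fin (n R) → Fin (n R) → Set
AdjU R a b = Arc R a b ⊎ Arc R b a

record UCycle (R : Digraph) : Set where
  field
    k     : ℕ
    c     : Fin (3 + k) → Fin (n R)
    inj   : Injective _≡_ _≡_ c
    adj   : ∀ (i : Fin (2 + k)) → AdjU R (c (inject₁ i)) (c (suc i))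
    close : AdjU R (c (fromℕ (2 + k))) (c zero)

record Arborescence : Set where
  field
    tree      : Digraph
    root      : Fin (n tree)
    noAnti    : ∀ a b → Arc tree a b → ¬ Arc tree b a
    acyclic   : ¬ UCycle tree
    reachable : ∀ t → Star (Arc tree) root t

open Arborescence public

record ArborealDecomposition (D : Digraph) : Set where
  field
    R       : Arborescence
  m : ℕ
  m = n (tree R)
  ArcR : Fin m → Fin m → Set
  ArcR = Arc (tree R)
  field
    -- X (s , t) is only relevant when (s , t) is an arc of R
    X        : Fin m → Fin m → Subset (n D)
    W        : Fin m → Subset (n D)
    nonempty : ∀ t → Nonempty (W t)
    disjoint : ∀ t u v → v ∈ W t → v ∈ W u → t ≡ u
    covers   : ∀ v → ∃ λ t → v ∈ W t
    normal   : ∀ s t → ArcR s t →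
               IsNormal D (X s t) (λ v → ∃ λ u → Star ArcR t u × v ∈ W u)

open ArborealDecomposition public

-- W_t ∪ ⋃ { X_e : e an arc of R incident with t }
bag : {D : Digraph} → (d : ArborealDecomposition D) → Fin (m d) → Subset (n D)
bag d t = W d t ∪ ⋃ (concatMap incident (allFin (m d)))
  where
  A = arc (tree (R d))
  incident : Fin (m d) → List _
  incident u = inc1 (A u t) (inc2 (A t u))
    where
    inc2 : Bool → List _
    inc2 true  = X d t u ∷ []
    inc2 false = []
    inc1 : Bool → List _ → List _
    inc1 true  l = X d u t ∷ l
    inc1 false l = l

-- width = max_t |bag t| - 1   (R has at least one node, its root,
-- and every bag is nonempty, so the subtraction is exact)
width : {D : Digraph} → ArborealDecomposition D → ℕ
width d = foldr _⊔_ 0 (map (λ t → ∣ bag d t ∣) (allFin (m d))) ∸ 1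

DTW≡ : Digraph → ℕ → Set
DTW≡ D k = (∃ λ (d : ArborealDecomposition D) → width d ≡ k) ×
           (∀ (d : ArborealDecomposition D) → k ≤ width d)

{-# OPTIONS --safe #-}
-- Take two copies of the complete K-ary tree of depth K, where K = r + 1. In
-- the first copy every node has arcs to its children and to all its proper
-- ancestors, the second copy is the reverse of the first, and every node of the
-- second copy has an arc to every node of the first; so all degrees are at
-- least K. The decomposition tree is the tree itself, with the root of the
-- second copy hung below the root of the first, W t = {t} and X (s , t) = {s};
-- every bag is {t, parent t}, so the width is at most 1. For normality of the
-- subtree Z below t, let Y be Z together with the first copy: avoiding the
-- parent of t, no arc leaves Y and no arc enters Z from Y ∖ Z, so a walk that
-- leaves Z never returns. Conversely, if all bags were singletons, the
-- one-vertex set X at the arc entering the bag of one end of a 2-cycle could not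
-- separate it from the other end, so each end's bag would lie below the other's.
module Submission where

open import Defs
open import Data.Bool using (Bool; true; false)
open import Data.Empty using (⊥; ⊥-elim)
open import Data.Fin using (Fin; zero; suc; _≟_; fromℕ; inject₁)
import Data.Fin as Fin
open import Data.Fin.Induction using (<-weakInduction-startingFrom)
open import Data.Fin.Properties using (suc-injective; 0≢1+n; ≤fromℕ; any?; 1↔⊤; +↔⊎; *↔×)
open import Data.Fin.Relation.Unary.Top using (view; ‵fromℕ; ‵inject₁)
open import Data.Fin.Subset using (Subset; _∈_; _∉_; _⊆_; _∪_; _-_; ⋃; ∣_∣; ⁅_⁆; inside; outside)
open import Data.Fin.Subset.Properties
  using (∉⊥; x∈⁅x⁆; x∈⁅y⁆⇒x≡y; x∉⁅y⁆⇒x≢y; ∣⁅x⁆∣≡1; p⊆p∪q; q⊆p∪q; x∈p∪q⁻; x∈p∪q⁺;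
         p⊆q⇒∣p∣≤∣q∣; x∈p⇒∣p-x∣<∣p∣; x∈p∧x≢y⇒x∈p-y)
open import Data.List using (List; _∷_; []; foldr; map; concatMap; allFin)
open import Data.List.Extrema.Nat using (argmax; f[xs]≤f[argmax])
open import Data.List.Membership.Propositional using (lose)
open import Data.List.Membership.Propositional.Properties using (∈-allFin)
open import Data.List.Properties using (foldr-preservesᵇ; foldr-forcesᵇ)
open import Data.List.Relation.Unary.All using (universal; lookup)
open import Data.List.Relation.Unary.All.Properties using (map⁺; map⁻)
open import Data.List.Relation.Unary.Any using (Any; here; there; satisfied)
open import Data.List.Relation.Unary.Any.Properties using (concatMap⁺; concatMap⁻)
open import Data.Nat using (ℕ; zero; suc; _+_; _*_; _⊔_; _≤_; _<_; _≤?_; z≤n; s≤s)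
open import Data.Nat.Properties
  using (≤-refl; ≤-reflexive; ≤-trans; ≤-antisym; ≤-pred; ≰⇒>; <-asym; n≤1+n; 1+n≰n; +-suc;
         +-monoʳ-≤; ∸-monoˡ-≤; m≤n+m∸n; ⊔-lub; m⊔n≤o⇒m≤o; m⊔n≤o⇒n≤o; module ≤-Reasoning)
open import Data.Product using (∃; ∃₂; _×_; _,_; proj₁; proj₂)
open import Data.Product.Function.NonDependent.Propositional using (_×-↔_)
open import Data.Sum using (_⊎_; inj₁; inj₂; [_,_]′; swap; map₂)
open import Data.Sum.Function.Propositional using (_⊎-↔_)
open import Data.Sum.Properties using (inj₁-injective; inj₂-injective)
open import Data.Unit using (⊤; tt)
open import Data.Vec using (_∷_; []; tabulate)
open import Data.Vec.Properties using (lookup∘tabulate; lookup⇒[]=)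
open import Function using (_∘_; flip)
open import Function.Bundles using (_↔_; _⇔_; Inverse; Equivalence; mk↔ₛ′; mk⇔)
open import Function.Definitions using (Injective)
open import Function.Properties.Inverse using (↔-refl; ↔-sym; ↔-trans)
open import Relation.Binary.Construct.Closure.ReflexiveTransitive using (Star; ε; _◅_; _◅◅_; gmap)
open import Relation.Binary.Definitions using (Decidable)
open import Relation.Binary.PropositionalEquality
open import Relation.Nullary using (¬_; yes; no; contradiction)
open import Relation.Nullary.Decidable using (does; dec-true; dec-false; map′; _⊎-dec_)

private variable
  N : ℕ

-- Finite subsets

injection⇒≤∣p∣ : ∀ {k} {p : Subset N} (f : Fin k → Fin N) → Injective _≡_ _≡_ f →
                 (∀ i → f i ∈ p) → k ≤ ∣ p ∣
injection⇒≤∣p∣ {k = zero}  f f-inj f∈p = z≤n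
injection⇒≤∣p∣ {k = suc k} f f-inj f∈p =
  ≤-trans (s≤s (injection⇒≤∣p∣ (f ∘ suc) (suc-injective ∘ f-inj) f[suc]∈p-f[0]))
          (x∈p⇒∣p-x∣<∣p∣ (f∈p zero))
  where
  f[suc]∈p-f[0] : ∀ i → f (suc i) ∈ _ - f zero
  f[suc]∈p-f[0] i = x∈p∧x≢y⇒x∈p-y (f∈p (suc i)) (0≢1+n ∘ sym ∘ f-inj)

∣p∣≤1⇒unique : ∀ {p : Subset N} {x y} → ∣ p ∣ ≤ 1 → x ∈ p → y ∈ p → x ≡ y
∣p∣≤1⇒unique {x = x} {y} ∣p∣≤1 x∈p y∈p with x ≟ y
... | yes x≡y = x≡y
... | no  x≢y = contradiction (≤-trans (injection⇒≤∣p∣ pair pair-inj pair∈p) ∣p∣≤1) 1+n≰n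
  where
  pair : Fin 2 → Fin _
  pair zero       = x
  pair (suc zero) = y
  pair-inj : Injective _≡_ _≡_ pair
  pair-inj {zero}     {zero}     _  = refl
  pair-inj {zero}     {suc zero} eq = contradiction eq x≢y
  pair-inj {suc zero} {zero}     eq = contradiction (sym eq) x≢y
  pair-inj {suc zero} {suc zero} _  = refl
  pair∈p : ∀ i → pair i ∈ _
  pair∈p zero       = x∈p
  pair∈p (suc zero) = y∈p

∣p∪q∣≤∣p∣+∣q∣ : ∀ (p q : Subset N) → ∣ p ∪ q ∣ ≤ ∣ p ∣ + ∣ q ∣
∣p∪q∣≤∣p∣+∣q∣ []            []            = z≤n
∣p∪q∣≤∣p∣+∣q∣ (outside ∷ p) (outside ∷ q) = ∣p∪q∣≤∣p∣+∣q∣ p q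
∣p∪q∣≤∣p∣+∣q∣ (inside ∷ p)  (outside ∷ q) = s≤s (∣p∪q∣≤∣p∣+∣q∣ p q)
∣p∪q∣≤∣p∣+∣q∣ (outside ∷ p) (inside ∷ q)  =
  ≤-trans (s≤s (∣p∪q∣≤∣p∣+∣q∣ p q)) (≤-reflexive (sym (+-suc ∣ p ∣ ∣ q ∣)))
∣p∪q∣≤∣p∣+∣q∣ (inside ∷ p)  (inside ∷ q)  =
  s≤s (≤-trans (∣p∪q∣≤∣p∣+∣q∣ p q) (+-monoʳ-≤ ∣ p ∣ (n≤1+n ∣ q ∣)))

∣p∣≤2 : ∀ {p : Subset N} {a b} → (∀ {x} → x ∈ p → x ≡ a ⊎ x ≡ b) → ∣ p ∣ ≤ 2
∣p∣≤2 {p = p} {a} {b} p⊆ab = begin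
  ∣ p ∣                 ≤⟨ p⊆q⇒∣p∣≤∣q∣ p⊆⁅a⁆∪⁅b⁆ ⟩
  ∣ ⁅ a ⁆ ∪ ⁅ b ⁆ ∣     ≤⟨ ∣p∪q∣≤∣p∣+∣q∣ ⁅ a ⁆ ⁅ b ⁆ ⟩
  ∣ ⁅ a ⁆ ∣ + ∣ ⁅ b ⁆ ∣ ≡⟨ cong₂ _+_ (∣⁅x⁆∣≡1 a) (∣⁅x⁆∣≡1 b) ⟩
  2                     ∎
  where
  open ≤-Reasoning
  p⊆⁅a⁆∪⁅b⁆ : p ⊆ ⁅ a ⁆ ∪ ⁅ b ⁆
  p⊆⁅a⁆∪⁅b⁆ x∈p with p⊆ab x∈p
  ... | inj₁ refl = p⊆p∪q ⁅ b ⁆ (x∈⁅x⁆ a)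
  ... | inj₂ refl = q⊆p∪q ⁅ a ⁆ ⁅ b ⁆ (x∈⁅x⁆ b)

∈-⋃⁻ : ∀ (ps : List (Subset N)) {x} → x ∈ ⋃ ps → Any (x ∈_) ps
∈-⋃⁻ []       x∈⋃ = contradiction x∈⋃ ∉⊥
∈-⋃⁻ (p ∷ ps) x∈⋃ = [ here , there ∘ ∈-⋃⁻ ps ]′ (x∈p∪q⁻ p (⋃ ps) x∈⋃)

∈-⋃⁺ : ∀ {ps : List (Subset N)} {x} → Any (x ∈_) ps → x ∈ ⋃ ps
∈-⋃⁺ (here x∈p)   = x∈p∪q⁺ (inj₁ x∈p)
∈-⋃⁺ (there x∈ps) = x∈p∪q⁺ (inj₂ (∈-⋃⁺ x∈ps))

∈-tabulate⁺ : ∀ (g : Fin N → Bool) {x} → g x ≡ true → x ∈ tabulate g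
∈-tabulate⁺ g {x} gx≡true = lookup⇒[]= x (tabulate g) (trans (lookup∘tabulate g x) gx≡true)

-- Walks and normal sets

last-step : ∀ {A : Set} {_~_ : A → A → Set} {x y} → Star _~_ x y →
            x ≡ y ⊎ ∃ λ w → Star _~_ x w × w ~ y
last-step ε = inj₁ refl
last-step (x~w ◅ w⇝y) with last-step w⇝y
... | inj₁ refl             = inj₂ (_ , ε , x~w)
... | inj₂ (v , w⇝v , v~y) = inj₂ (v , x~w ◅ w⇝v , v~y)

Arc-irreflexive : ∀ {D : Digraph} {x} → ¬ Arc D x x
Arc-irreflexive {D} {x} xx with trans (sym xx) (loopless D x)
... | ()

round-trip : ∀ {D : Digraph} {x y} → Arc D x y → Arc D y x → Walk D
round-trip {D} {x} {y} xy yx = record { len = 2 ; vtx = vtx′ ; steps = steps′ }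
  where
  vtx′ : Fin 3 → Fin (n D)
  vtx′ zero             = x
  vtx′ (suc zero)       = y
  vtx′ (suc (suc zero)) = x
  steps′ : ∀ i → Arc D (vtx′ (inject₁ i)) (vtx′ (suc i))
  steps′ zero       = xy
  steps′ (suc zero) = yx

ClosedIn : (D : Digraph) → Subset (n D) → (Fin (n D) → Set) → Set
ClosedIn D X P = ∀ {x y} → x ∉ X → y ∉ X → Arc D x y → P x → P y

closed-along : ∀ {D X P} → ClosedIn D X P → (w : Walk D) → (∀ i → vtx w i ∉ X) →
               ∀ {i j} → i Fin.≤ j → P (vtx w i) → P (vtx w j)
closed-along {P = P} closed w avoids i≤j P[i] =
  <-weakInduction-startingFrom (P ∘ vtx w) P[i] (λ j → closed (avoids _) (avoids _) (steps w j)) i≤j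

-- A walk of D - X starting in Z stays in Y, and once it has left Z it cannot return.
trapped⇒normal : ∀ {D X} (Y Z : Fin (n D) → Set) →
                 (∀ v → Z v → v ∉ X) → (∀ {v} → Z v → Y v) →
                 ClosedIn D X Y → ClosedIn D X (λ v → Y v × ¬ Z v) → IsNormal D X Z
trapped⇒normal Y Z Z∩X≡∅ Z⊆Y Y-closed Y∖Z-closed =
  Z∩X≡∅ , λ (w , avoids , Z-first , Z-last , i , ¬Z-i) →
    let Y-i = closed-along Y-closed w avoids {zero} {i} z≤n (Z⊆Y Z-first)
    in  proj₂ (closed-along Y∖Z-closed w avoids (≤fromℕ i) (Y-i , ¬Z-i)) Z-last

IsNormal-resp : ∀ {D X} {Z Z′ : Fin (n D) → Set} → (∀ v → Z v ⇔ Z′ v) →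
                IsNormal D X Z → IsNormal D X Z′
IsNormal-resp Z⇔Z′ (Z∩X≡∅ , no-detour) =
  (λ v → Z∩X≡∅ v ∘ from (Z⇔Z′ v)) ,
  λ (w , avoids , Z′-first , Z′-last , i , ¬Z′-i) →
    no-detour (w , avoids , from (Z⇔Z′ _) Z′-first , from (Z⇔Z′ _) Z′-last , i , ¬Z′-i ∘ to (Z⇔Z′ _))
  where open Equivalence

-- Bags and width

module _ {D : Digraph} (d : ArborealDecomposition D) where

  -- `bag` is defined through local functions of Defs; the equation below lets
  -- unification name them, so that `with` can inspect the arcs they test.
  private
    ∈-bag⁺ : ∀ {B V x} (incident : Fin (m d) → List (Subset (n D))) →
             B ≡ V ∪ ⋃ (concatMap incident (allFin (m d))) →
             ∀ u → Any (x ∈_) (incident u) → x ∈ B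
    ∈-bag⁺ {V = V} incident refl u x∈incident =
      q⊆p∪q V _ (∈-⋃⁺ (concatMap⁺ incident (lose (∈-allFin u) x∈incident)))

    ∈-bag⁻′ : ∀ {B V x} (incident : Fin (m d) → List (Subset (n D))) →
              B ≡ V ∪ ⋃ (concatMap incident (allFin (m d))) →
              x ∈ B → x ∈ V ⊎ ∃ λ u → Any (x ∈_) (incident u)
    ∈-bag⁻′ {V = V} incident refl x∈B with x∈p∪q⁻ V _ x∈B
    ... | inj₁ x∈V = inj₁ x∈V
    ... | inj₂ x∈⋃ = inj₂ (satisfied (concatMap⁻ incident {xs = allFin (m d)} (∈-⋃⁻ _ x∈⋃)))

  ∈-bag⁻ : ∀ {t x} → x ∈ bag d t →
           x ∈ W d t ⊎ ∃ λ u → (ArcR d u t × x ∈ X d u t) ⊎ (ArcR d t u × x ∈ X d t u)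
  ∈-bag⁻ {t} x∈bag with ∈-bag⁻′ {bag d t} {W d t} _ refl x∈bag
  ... | inj₁ x∈W = inj₁ x∈W
  ... | inj₂ (u , x∈incident) with arc (tree (R d)) u t in ut | arc (tree (R d)) t u in tu | x∈incident
  ...   | true  | _     | here x∈X         = inj₂ (u , inj₁ (ut , x∈X))
  ...   | true  | true  | there (here x∈X) = inj₂ (u , inj₂ (tu , x∈X))
  ...   | false | true  | here x∈X         = inj₂ (u , inj₂ (tu , x∈X))

  X⊆bag : ∀ {s t} → ArcR d s t → X d s t ⊆ bag d t
  X⊆bag {s} {t} st {x} x∈X with ∈-bag⁺ {bag d t} {W d t} {x} _ refl s
  ... | x∈bag with arc (tree (R d)) s t
  ...   | true = x∈bag (here x∈X)

  private
    largest-bag : ℕ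
    largest-bag = foldr _⊔_ 0 (map (λ t → ∣ bag d t ∣) (allFin (m d)))

  width≤ : ∀ {k} → (∀ t → ∣ bag d t ∣ ≤ suc k) → width d ≤ k
  width≤ {k} bags≤ = ∸-monoˡ-≤ 1 largest≤
    where
    largest≤ : largest-bag ≤ suc k
    largest≤ = foldr-preservesᵇ {P = _≤ suc k} {f = _⊔_} ⊔-lub z≤n (map⁺ (universal bags≤ (allFin (m d))))

  bag≤ : ∀ {k} → width d ≤ k → ∀ t → ∣ bag d t ∣ ≤ suc k
  bag≤ {k} width≤k t = lookup (map⁻ (foldr-forcesᵇ ⊔≤-split 0 _ largest≤)) (∈-allFin t)
    where
    ⊔≤-split : ∀ a b → a ⊔ b ≤ suc k → a ≤ suc k × b ≤ suc k
    ⊔≤-split a b a⊔b≤ = m⊔n≤o⇒m≤o a b a⊔b≤ , m⊔n≤o⇒n≤o a b a⊔b≤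
    largest≤ : largest-bag ≤ suc k
    largest≤ = ≤-trans (m≤n+m∸n largest-bag 1) (s≤s width≤k)

-- Arborescences

module SimplePaths (G : Digraph) where

  private variable
    k : ℕ
    x y z : Fin (n G)

  infixr 5 _∷_
  data Path : Fin (n G) → Fin (n G) → ℕ → Set where
    []  : Path x x 0
    _∷_ : Arc G x y → Path y z k → Path x z (suc k)

  vertex : Path x z k → Fin (suc k) → Fin (n G)
  vertex {x = x} _ zero    = x
  vertex (_ ∷ p)   (suc i) = vertex p i

  vertex-last : (p : Path x z k) → vertex p (fromℕ k) ≡ z
  vertex-last []      = refl
  vertex-last (_ ∷ p) = vertex-last p

  vertex-step : (p : Path x z k) (i : Fin k) → Arc G (vertex p (inject₁ i)) (vertex p (suc i))
  vertex-step (xy ∷ _) zero    = xy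
  vertex-step (_ ∷ p)  (suc i) = vertex-step p i

  Simple : Path x z k → Set
  Simple []                = ⊤
  Simple (_∷_ {x = x} _ p) = (∀ i → vertex p i ≢ x) × Simple p

  vertex-injective : (p : Path x z k) → Simple p → Injective _≡_ _≡_ (vertex p)
  vertex-injective _       _            {zero}  {zero}  _  = refl
  vertex-injective (_ ∷ p) (x∉p , _)    {zero}  {suc j} eq = contradiction (sym eq) (x∉p j)
  vertex-injective (_ ∷ p) (x∉p , _)    {suc i} {zero}  eq = contradiction eq (x∉p i)
  vertex-injective (_ ∷ p) (_ , simple) {suc i} {suc j} eq = cong suc (vertex-injective p simple eq)

  SimplePath : Fin (n G) → Fin (n G) → Set
  SimplePath x z = ∃₂ λ k (p : Path x z k) → Simple p

  suffix : (p : Path x z k) → Simple p → ∀ i → SimplePath (vertex p i) z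
  suffix p       simple       zero    = _ , p , simple
  suffix (_ ∷ p) (_ , simple) (suc i) = suffix p simple i

  shorten : Star (Arc G) x z → SimplePath x z
  shorten ε = 0 , [] , tt
  shorten {x = x} (xy ◅ y⇝z) with shorten y⇝z
  ... | k , p , simple with any? (λ i → vertex p i ≟ x)
  ...   | yes (i , pᵢ≡x) = subst (λ v → SimplePath v _) pᵢ≡x (suffix p simple i)
  ...   | no  x∉p        = suc k , xy ∷ p , (λ i pᵢ≡x → x∉p (i , pᵢ≡x)) , simple

module _ (T : Arborescence) where
  open SimplePaths (tree T)

  no-closed-walk : ∀ {a b} → Arc (tree T) a b → Star (Arc (tree T)) b a → ⊥
  no-closed-walk {a} {b} ab b⇝a with shorten b⇝a
  ... | 0           , []      , _      = Arc-irreflexive {tree T} ab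
  ... | 1           , ba ∷ [] , _      = noAnti T a b ab ba
  ... | suc (suc k) , p       , simple = acyclic T (record
    { k     = k
    ; c     = vertex p
    ; inj   = vertex-injective p simple
    ; adj   = inj₁ ∘ vertex-step p
    ; close = inj₁ (subst (λ v → Arc (tree T) v b) (sym (vertex-last p)) ab)
    })

  Star-antisym : ∀ {a b} → Star (Arc (tree T)) a b → Star (Arc (tree T)) b a → a ≡ b
  Star-antisym ε          _   = refl
  Star-antisym (ab ◅ b⇝c) c⇝a = ⊥-elim (no-closed-walk ab (b⇝c ◅◅ c⇝a))

inject₁²≢suc² : ∀ {n} (i : Fin n) → inject₁ (inject₁ i) ≢ suc (suc i)
inject₁²≢suc² zero    ()
inject₁²≢suc² (suc i) = inject₁²≢suc² i ∘ suc-injective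

module _ {G : Digraph} (C : UCycle G) where
  open UCycle C

  UCycle-neighbours : ∀ i → ∃₂ λ j₁ j₂ → j₁ ≢ j₂ × AdjU G (c j₁) (c i) × AdjU G (c j₂) (c i)
  UCycle-neighbours zero = suc zero , fromℕ (2 + k) , (λ ()) , swap (adj zero) , close
  UCycle-neighbours (suc j) with view j
  ... | ‵fromℕ      = inject₁ j , zero , (λ ()) , adj j , swap close
  ... | ‵inject₁ j′ = inject₁ j , suc (suc j′) , inject₁²≢suc² j′ , adj j , swap (adj (suc j′))

max-index : ∀ {n} (f : Fin (suc n) → ℕ) → ∃ λ i → ∀ j → f j ≤ f i
max-index f = argmax f zero (allFin _) , λ j → lookup (f[xs]≤f[argmax] {f = f} zero (allFin _)) (∈-allFin j)

-- On a cycle, the vertex of greatest height would have two distinct parents.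
height-parent⇒¬UCycle : ∀ (G : Digraph) (height : Fin (n G) → ℕ) →
                        (∀ {x y} → Arc G x y → height y ≡ suc (height x)) →
                        (∀ {x y z} → Arc G x z → Arc G y z → x ≡ y) → ¬ UCycle G
height-parent⇒¬UCycle G height height-step parent-unique C = two-parents (UCycle-neighbours C top)
  where
  open UCycle C
  top : Fin (3 + k)
  top = proj₁ (max-index (height ∘ c))
  top-highest : ∀ j → height (c j) ≤ height (c top)
  top-highest = proj₂ (max-index (height ∘ c))
  into-top : ∀ {j} → AdjU G (c j) (c top) → Arc G (c j) (c top)
  into-top     (inj₁ j→top) = j→top
  into-top {j} (inj₂ top→j) =
    contradiction (subst (_≤ height (c top)) (height-step top→j) (top-highest j)) 1+n≰n
  two-parents : ¬ ∃₂ λ j₁ j₂ → j₁ ≢ j₂ × AdjU G (c j₁) (c top) × AdjU G (c j₂) (c top)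
  two-parents (j₁ , j₂ , j₁≢j₂ , adj₁ , adj₂) = j₁≢j₂ (inj (parent-unique (into-top adj₁) (into-top adj₂)))

height-arborescence : (T : Digraph) (root : Fin (n T)) (height : Fin (n T) → ℕ) →
                      (∀ {x y} → Arc T x y → height y ≡ suc (height x)) →
                      (∀ {x y z} → Arc T x z → Arc T y z → x ≡ y) →
                      (∀ t → Star (Arc T) root t) → Arborescence
height-arborescence T root height height-step parent-unique reach = record
  { tree      = T
  ; root      = root
  ; noAnti    = λ a b ab ba → <-asym (ascends ab) (ascends ba)
  ; acyclic   = height-parent⇒¬UCycle T height height-step parent-unique
  ; reachable = reach
  }
  where
  ascends : ∀ {x y} → Arc T x y → height x < height y
  ascends xy = ≤-reflexive (sym (height-step xy))

-- Lower bound

HasTwoCycle : Digraph → Set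
HasTwoCycle D = ∃₂ λ u v → Arc D u v × Arc D v u

module _ {D : Digraph} (d : ArborealDecomposition D) (small : ∀ t → ∣ bag d t ∣ ≤ 1) where

  private
    _⇝_ : Fin (m d) → Fin (m d) → Set
    _⇝_ = Star (ArcR d)

  -- If b is not the root, the one-vertex set X at the arc entering b cannot
  -- separate x ∈ W b from its partner in a 2-cycle, so the partner lies below b.
  two-cycle-below : ∀ {b c x y} → x ∈ W d b → y ∈ W d c → Arc D x y → Arc D y x → ¬ ¬ (b ⇝ c)
  two-cycle-below {b} {c} {x} {y} x∈b y∈c xy yx ¬b⇝c with last-step (reachable (R d) b)
  ... | inj₁ refl         = ¬b⇝c (reachable (R d) c)
  ... | inj₂ (s , _ , sb) =
    no-detour (round-trip xy yx , avoids , x-below , x-below , suc zero , y-not-below)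
    where
    Z∩X≡∅ = proj₁ (normal d s b sb)
    no-detour = proj₂ (normal d s b sb)
    x-below = b , ε , x∈b
    y-not-below : ¬ ∃ λ w → b ⇝ w × y ∈ W d w
    y-not-below (w , b⇝w , y∈w) = ¬b⇝c (subst (b ⇝_) (disjoint d w c y y∈w y∈c) b⇝w)
    y∉X : y ∉ X d s b
    y∉X y∈X = Arc-irreflexive {D}
      (subst (Arc D x) (sym (∣p∣≤1⇒unique (small b) (p⊆p∪q _ x∈b) (X⊆bag d sb y∈X))) xy)
    avoids : ∀ i → vtx (round-trip xy yx) i ∉ X d s b
    avoids zero             = Z∩X≡∅ x x-below
    avoids (suc zero)       = y∉X
    avoids (suc (suc zero)) = Z∩X≡∅ x x-below

  small-bags⇒¬HasTwoCycle : ¬ HasTwoCycle D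
  small-bags⇒¬HasTwoCycle (u , v , uv , vu) with covers d u | covers d v
  ... | a , u∈a | b , v∈b =
    two-cycle-below u∈a v∈b uv vu λ a⇝b →
    two-cycle-below v∈b u∈a vu uv λ b⇝a →
    a≢b (Star-antisym (R d) a⇝b b⇝a)
    where
    a≢b : a ≢ b
    a≢b refl = Arc-irreflexive {D}
      (subst (Arc D u) (sym (∣p∣≤1⇒unique (small a) (p⊆p∪q _ u∈a) (p⊆p∪q _ v∈b))) uv)

HasTwoCycle⇒1≤width : ∀ {D} → HasTwoCycle D → (d : ArborealDecomposition D) → 1 ≤ width d
HasTwoCycle⇒1≤width two-cycle d with 1 ≤? width d
... | yes 1≤width = 1≤width
... | no  1≰width = ⊥-elim (small-bags⇒¬HasTwoCycle d (bag≤ d (≤-pred (≰⇒> 1≰width))) two-cycle)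

DTW≡1 : ∀ {D} → HasTwoCycle D → (d : ArborealDecomposition D) → width d ≤ 1 → DTW≡ D 1
DTW≡1 two-cycle d width≤1 =
  (d , ≤-antisym width≤1 (HasTwoCycle⇒1≤width two-cycle d)) , HasTwoCycle⇒1≤width two-cycle

-- Digraphs on an encoded vertex type

Successors : ∀ {A : Set} → (A → A → Set) → A → ℕ → Set
Successors {A} _~_ x k = ∃ λ (f : Fin k → A) → Injective _≡_ _≡_ f × ∀ i → x ~ f i

module FinEncoding {V : Set} (V↔Fin : V ↔ Fin N) where

  open Inverse V↔Fin public
    using () renaming (to to encode; from to decode;
                       strictlyInverseˡ to encode∘decode; strictlyInverseʳ to decode∘encode)

  decode-injective : ∀ {i j} → decode i ≡ decode j → i ≡ j
  decode-injective {i} {j} eq = trans (sym (encode∘decode i)) (trans (cong encode eq) (encode∘decode j))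

  encode-injective : ∀ {x y} → encode x ≡ encode y → x ≡ y
  encode-injective {x} {y} eq = trans (sym (decode∘encode x)) (trans (cong decode eq) (decode∘encode y))

  module EncodedDigraph {E : V → V → Set} (E? : Decidable E) (E-irrefl : ∀ x → ¬ E x x) where

    digraph : Digraph
    digraph = record
      { n        = N
      ; arc      = λ i j → does (E? (decode i) (decode j))
      ; loopless = λ i → dec-false (E? _ _) (E-irrefl (decode i))
      }

    Arc⇒E : ∀ {i j} → Arc digraph i j → E (decode i) (decode j)
    Arc⇒E {i} {j} arc with E? (decode i) (decode j)
    ... | yes e = e

    E⇒Arc : ∀ {x y} → E x y → Arc digraph (encode x) (encode y)
    E⇒Arc {x} {y} e = dec-true (E? _ _) (subst₂ E (sym (decode∘encode x)) (sym (decode∘encode y)) e)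

    Star⇔ : ∀ {i j} → Star (Arc digraph) i j ⇔ Star E (decode i) (decode j)
    Star⇔ {i} {j} = mk⇔ (gmap decode Arc⇒E) from
      where
      from : Star E (decode i) (decode j) → Star (Arc digraph) i j
      from p = subst₂ (Star (Arc digraph)) (encode∘decode i) (encode∘decode j) (gmap encode E⇒Arc p)

    outdeg≥ : ∀ {k} i → Successors E (decode i) k → k ≤ outdeg digraph i
    outdeg≥ i (f , f-inj , i→f) = injection⇒≤∣p∣ (encode ∘ f) (f-inj ∘ encode-injective) λ a →
      ∈-tabulate⁺ (arc digraph i) (subst (λ x → Arc digraph x _) (encode∘decode i) (E⇒Arc (i→f a)))

    indeg≥ : ∀ {k} i → Successors (flip E) (decode i) k → k ≤ indeg digraph i
    indeg≥ i (f , f-inj , f→i) = injection⇒≤∣p∣ (encode ∘ f) (f-inj ∘ encode-injective) λ a →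
      ∈-tabulate⁺ (λ j → arc digraph j i) (subst (Arc digraph _) (encode∘decode i) (E⇒Arc (f→i a)))

-- The construction

-- K = r + 1 rather than r, so that for r = 0 the tree still has an edge and D a 2-cycle.
module Construction (r : ℕ) where

  K : ℕ
  K = suc r

  -- Node d is the complete K-ary tree of depth d: a ∷ s is the node s of the
  -- subtree below the a-th child of the root, so children extend a word at its end.
  infixr 5 _∷_
  data Node : ℕ → Set where
    []  : ∀ {d} → Node d
    _∷_ : ∀ {d} → Fin K → Node d → Node (suc d)

  private variable
    d : ℕ
    a : Fin K
    s t u : Node d

  ∷-injectiveˡ : ∀ {b} {s t : Node d} → a ∷ s ≡ b ∷ t → a ≡ b
  ∷-injectiveˡ refl = refl

  ∷-injectiveʳ : ∀ {b} {s t : Node d} → a ∷ s ≡ b ∷ t → s ≡ t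
  ∷-injectiveʳ refl = refl

  infix 4 _⋖_ _≺_ _↝_

  data _⋖_ : Node d → Node d → Set where
    []⋖  : [] ⋖ a ∷ [] {d}
    ∷⋖∷ : s ⋖ t → a ∷ s ⋖ a ∷ t

  data _≺_ : Node d → Node d → Set where
    []≺  : [] ≺ a ∷ s
    ∷≺∷ : s ≺ t → a ∷ s ≺ a ∷ t

  data _↝_ : Node d → Node d → Set where
    child    : s ⋖ t → s ↝ t
    ancestor : t ≺ s → s ↝ t

  _⋖?_ : Decidable (_⋖_ {d})
  []      ⋖? []          = no λ ()
  []      ⋖? (_ ∷ [])    = yes []⋖
  []      ⋖? (_ ∷ _ ∷ _) = no λ ()
  (_ ∷ _) ⋖? []          = no λ ()
  (a ∷ s) ⋖? (b ∷ t) with a ≟ b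
  ... | no  a≢b  = no λ { (∷⋖∷ _) → a≢b refl }
  ... | yes refl = map′ ∷⋖∷ (λ { (∷⋖∷ s⋖t) → s⋖t }) (s ⋖? t)

  _≺?_ : Decidable (_≺_ {d})
  []      ≺? []      = no λ ()
  []      ≺? (_ ∷ _) = yes []≺
  (_ ∷ _) ≺? []      = no λ ()
  (a ∷ s) ≺? (b ∷ t) with a ≟ b
  ... | no  a≢b  = no λ { (∷≺∷ _) → a≢b refl }
  ... | yes refl = map′ ∷≺∷ (λ { (∷≺∷ s≺t) → s≺t }) (s ≺? t)

  _↝?_ : Decidable (_↝_ {d})
  s ↝? t = map′ [ child , ancestor ]′ (λ { (child s⋖t) → inj₁ s⋖t ; (ancestor t≺s) → inj₂ t≺s })
                (s ⋖? t ⊎-dec t ≺? s)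

  ⋖-irrefl : ¬ s ⋖ s
  ⋖-irrefl (∷⋖∷ s⋖s) = ⋖-irrefl s⋖s

  ≺-irrefl : ¬ s ≺ s
  ≺-irrefl (∷≺∷ s≺s) = ≺-irrefl s≺s

  ↝-irrefl : ¬ s ↝ s
  ↝-irrefl (child s⋖s)    = ⋖-irrefl s⋖s
  ↝-irrefl (ancestor s≺s) = ≺-irrefl s≺s

  depth : Node d → ℕ
  depth []      = 0
  depth (_ ∷ s) = suc (depth s)

  ⋖-depth : s ⋖ t → depth t ≡ suc (depth s)
  ⋖-depth []⋖       = refl
  ⋖-depth (∷⋖∷ s⋖t) = cong suc (⋖-depth s⋖t)

  parent : Node d → Node d
  parent []          = []
  parent (_ ∷ [])    = []
  parent (a ∷ b ∷ s) = a ∷ parent (b ∷ s)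

  ⋖-parent : s ⋖ t → s ≡ parent t
  ⋖-parent []⋖                = refl
  ⋖-parent (∷⋖∷ []⋖)          = refl
  ⋖-parent (∷⋖∷ s⋖t@(∷⋖∷ _)) = cong (_ ∷_) (⋖-parent s⋖t)

  []⋖* : (u : Node d) → Star _⋖_ [] u
  []⋖* []      = ε
  []⋖* (a ∷ u) = []⋖ ◅ gmap (a ∷_) ∷⋖∷ ([]⋖* u)

  ≺⇒⋖* : s ≺ t → Star _⋖_ s t
  ≺⇒⋖* []≺        = []⋖* _
  ≺⇒⋖* (∷≺∷ s≺t) = gmap (_ ∷_) ∷⋖∷ (≺⇒⋖* s≺t)

  ↝-into-subtree : s ↝ t → Star _⋖_ u t → Star _⋖_ u s ⊎ s ⋖ u
  ↝-into-subtree (ancestor t≺s) u⋖*t = inj₁ (u⋖*t ◅◅ ≺⇒⋖* t≺s)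
  ↝-into-subtree (child s⋖t)    u⋖*t with last-step u⋖*t
  ... | inj₁ refl             = inj₂ s⋖t
  ... | inj₂ (w , u⋖*w , w⋖t) =
    inj₁ (subst (Star _⋖_ _) (trans (⋖-parent w⋖t) (sym (⋖-parent s⋖t))) u⋖*w)

  children-or-ancestors : (u : Node d) → Successors _⋖_ u K ⊎ Successors (flip _≺_) u d
  children-or-ancestors {zero}  [] = inj₂ ((λ ()) , (λ { {()} }) , λ ())
  children-or-ancestors {suc d} [] = inj₁ ((_∷ []) , ∷-injectiveˡ , λ _ → []⋖)
  children-or-ancestors (a ∷ u) with children-or-ancestors u
  ... | inj₁ (f , f-inj , u⋖f) = inj₁ ((a ∷_) ∘ f , f-inj ∘ ∷-injectiveʳ , ∷⋖∷ ∘ u⋖f)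
  ... | inj₂ (f , f-inj , f≺u) = inj₂ (g , g-inj , g≺a∷u)
    where
    g : Fin (suc _) → Node (suc _)
    g zero    = []
    g (suc i) = a ∷ f i
    g-inj : Injective _≡_ _≡_ g
    g-inj {zero}  {zero}  _  = refl
    g-inj {zero}  {suc _} ()
    g-inj {suc _} {zero}  ()
    g-inj {suc i} {suc j} eq = cong suc (f-inj (∷-injectiveʳ eq))
    g≺a∷u : ∀ i → g i ≺ a ∷ u
    g≺a∷u zero    = []≺
    g≺a∷u (suc i) = ∷≺∷ (f≺u i)

  ↝-successors : (u : Node K) → Successors _↝_ u K
  ↝-successors u with children-or-ancestors u
  ... | inj₁ (f , f-inj , u⋖f) = f , f-inj , child ∘ u⋖f
  ... | inj₂ (f , f-inj , f≺u) = f , f-inj , ancestor ∘ f≺u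

  size : ℕ → ℕ
  size zero    = 1
  size (suc d) = 1 + K * size d

  Node↔⊤⊎ : Node (suc d) ↔ (⊤ ⊎ Fin K × Node d)
  Node↔⊤⊎ = mk↔ₛ′ to from to∘from from∘to
    where
    to : Node (suc _) → ⊤ ⊎ Fin K × Node _
    to []      = inj₁ tt
    to (a ∷ s) = inj₂ (a , s)
    from : ⊤ ⊎ Fin K × Node _ → Node (suc _)
    from (inj₁ tt)      = []
    from (inj₂ (a , s)) = a ∷ s
    to∘from : ∀ x → to (from x) ≡ x
    to∘from (inj₁ tt)      = refl
    to∘from (inj₂ (a , s)) = refl
    from∘to : ∀ s → from (to s) ≡ s
    from∘to []      = refl
    from∘to (a ∷ s) = refl

  Node↔Fin : ∀ d → Node d ↔ Fin (size d)
  Node↔Fin zero    = mk↔ₛ′ (λ _ → zero) (λ _ → []) (λ { zero → refl }) (λ { [] → refl })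
  Node↔Fin (suc d) =
    ↔-trans Node↔⊤⊎ (↔-trans (↔-sym 1↔⊤ ⊎-↔ (↔-refl ×-↔ Node↔Fin d))
                    (↔-trans (↔-refl ⊎-↔ ↔-sym *↔×) (↔-sym +↔⊎)))

  V : Set
  V = Node K ⊎ Node K

  pattern fwd u = inj₁ u
  pattern rev u = inj₂ u

  private variable
    x y z : V

  data _⟶_ : V → V → Set where
    fwd-arc : s ↝ t → fwd s ⟶ fwd t
    rev-arc : t ↝ s → rev s ⟶ rev t
    across  : rev s ⟶ fwd t

  _⟶?_ : Decidable _⟶_
  fwd s ⟶? fwd t = map′ fwd-arc (λ { (fwd-arc s↝t) → s↝t }) (s ↝? t)
  fwd s ⟶? rev t = no λ ()
  rev s ⟶? fwd t = yes across
  rev s ⟶? rev t = map′ rev-arc (λ { (rev-arc t↝s) → t↝s }) (t ↝? s)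

  ⟶-irrefl : ∀ x → ¬ x ⟶ x
  ⟶-irrefl (fwd s) (fwd-arc s↝s) = ↝-irrefl s↝s
  ⟶-irrefl (rev s) (rev-arc s↝s) = ↝-irrefl s↝s

  out-successors : ∀ x → Successors _⟶_ x K
  out-successors (fwd s) =
    let f , f-inj , s↝f = ↝-successors s
    in  (λ a → fwd (f a)) , (λ eq → f-inj (inj₁-injective eq)) , (λ a → fwd-arc (s↝f a))
  out-successors (rev s) =
    (λ a → fwd (a ∷ [])) , (λ eq → ∷-injectiveˡ (inj₁-injective eq)) , λ _ → across

  in-successors : ∀ x → Successors (flip _⟶_) x K
  in-successors (fwd s) =
    (λ a → rev (a ∷ [])) , (λ eq → ∷-injectiveˡ (inj₂-injective eq)) , λ _ → across
  in-successors (rev s) =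
    let f , f-inj , s↝f = ↝-successors s
    in  (λ a → rev (f a)) , (λ eq → f-inj (inj₂-injective eq)) , (λ a → rev-arc (s↝f a))

  data _⇾_ : V → V → Set where
    fwd-edge : s ⋖ t → fwd s ⇾ fwd t
    rev-edge : s ⋖ t → rev s ⇾ rev t
    bridge   : fwd [] ⇾ rev []

  _⇾?_ : Decidable _⇾_
  fwd s       ⇾? fwd t       = map′ fwd-edge (λ { (fwd-edge s⋖t) → s⋖t }) (s ⋖? t)
  rev s       ⇾? rev t       = map′ rev-edge (λ { (rev-edge s⋖t) → s⋖t }) (s ⋖? t)
  fwd []      ⇾? rev []      = yes bridge
  fwd []      ⇾? rev (_ ∷ _) = no λ ()
  fwd (_ ∷ _) ⇾? rev _       = no λ ()
  rev _       ⇾? fwd _       = no λ ()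

  ⇾-irrefl : ∀ x → ¬ x ⇾ x
  ⇾-irrefl (fwd s) (fwd-edge s⋖s) = ⋖-irrefl s⋖s
  ⇾-irrefl (rev s) (rev-edge s⋖s) = ⋖-irrefl s⋖s

  height : V → ℕ
  height (fwd s) = depth s
  height (rev s) = suc (depth s)

  ⇾-height : x ⇾ y → height y ≡ suc (height x)
  ⇾-height (fwd-edge s⋖t) = ⋖-depth s⋖t
  ⇾-height (rev-edge s⋖t) = cong suc (⋖-depth s⋖t)
  ⇾-height bridge         = refl

  ⇾*-height : Star _⇾_ x y → height x ≤ height y
  ⇾*-height ε             = ≤-refl
  ⇾*-height (x⇾y ◅ y⇾*z) = ≤-trans (n≤1+n _) (subst (_≤ _) (⇾-height x⇾y) (⇾*-height y⇾*z))

  parentᵀ : V → V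
  parentᵀ (fwd s)       = fwd (parent s)
  parentᵀ (rev [])      = fwd []
  parentᵀ (rev (a ∷ s)) = rev (parent (a ∷ s))

  ⇾-parent : x ⇾ y → x ≡ parentᵀ y
  ⇾-parent (fwd-edge s⋖t)         = cong fwd (⋖-parent s⋖t)
  ⇾-parent (rev-edge s⋖t@[]⋖)     = cong rev (⋖-parent s⋖t)
  ⇾-parent (rev-edge s⋖t@(∷⋖∷ _)) = cong rev (⋖-parent s⋖t)
  ⇾-parent bridge                 = refl

  ⇾-parent-unique : x ⇾ z → y ⇾ z → x ≡ y
  ⇾-parent-unique x⇾z y⇾z = trans (⇾-parent x⇾z) (sym (⇾-parent y⇾z))

  Below : V → V → Set
  Below (fwd s) (fwd t) = Star _⋖_ s t
  Below (fwd s) (rev t) = s ≡ []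
  Below (rev s) (fwd t) = ⊥
  Below (rev s) (rev t) = Star _⋖_ s t

  ⇾-Below : x ⇾ y → Below y z → Below x z
  ⇾-Below {z = fwd _} (fwd-edge s⋖t) t⋖*u = s⋖t ◅ t⋖*u
  ⇾-Below {z = rev _} (fwd-edge ())  refl
  ⇾-Below {z = rev _} (rev-edge s⋖t) t⋖*u = s⋖t ◅ t⋖*u
  ⇾-Below {z = rev _} bridge         _    = refl

  ⇾*⇔Below : Star _⇾_ x y ⇔ Below x y
  ⇾*⇔Below = mk⇔ to from
    where
    to : Star _⇾_ x y → Below x y
    to {fwd _} ε            = ε
    to {rev _} ε            = ε
    to         (x⇾y ◅ y⇾*z) = ⇾-Below x⇾y (to y⇾*z)
    from : Below x y → Star _⇾_ x y
    from {fwd s} {fwd t} s⋖*t = gmap fwd fwd-edge s⋖*t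
    from {fwd s} {rev t} refl = bridge ◅ gmap rev rev-edge ([]⋖* t)
    from {rev s} {rev t} s⋖*t = gmap rev rev-edge s⋖*t

  []-Below : ∀ x → Below (fwd []) x
  []-Below (fwd t) = []⋖* t
  []-Below (rev t) = refl

  fwd-subtree-entry : s ↝ t → Below x (fwd t) → Below x (fwd s) ⊎ fwd s ⇾ x
  fwd-subtree-entry {x = fwd u} s↝t u⋖*t = map₂ fwd-edge (↝-into-subtree s↝t u⋖*t)

  rev-subtree-exit : t ↝ s → Below x (rev s) → Below x (rev t) ⊎ rev t ⇾ x
  rev-subtree-exit {x = fwd _} _   refl = inj₁ refl
  rev-subtree-exit {x = rev u} t↝s u⋖*s = map₂ rev-edge (↝-into-subtree t↝s u⋖*s)

  IsFwd : V → Set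
  IsFwd (fwd _) = ⊤
  IsFwd (rev _) = ⊥

  module Trap {p t : V} (p⇾t : p ⇾ t) where

    Y : V → Set
    Y x = Below t x ⊎ IsFwd x

    Below∌parent : Below t x → x ≢ p
    Below∌parent t↓p refl =
      1+n≰n (subst (_≤ height p) (⇾-height p⇾t) (⇾*-height (Equivalence.from ⇾*⇔Below t↓p)))

    Y-closed : x ≢ p → y ≢ p → x ⟶ y → Y x → Y y
    Y-closed _ _   (fwd-arc _)   _          = inj₂ tt
    Y-closed _ _   across        _          = inj₂ tt
    Y-closed _ y≢p (rev-arc t↝s) (inj₁ t↓x) =
      [ inj₁ , (λ y⇾t → contradiction (⇾-parent-unique y⇾t p⇾t) y≢p) ]′ (rev-subtree-exit t↝s t↓x)

    Y∖Below-closed : x ≢ p → x ⟶ y → Y x × ¬ Below t x → Y y × ¬ Below t y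
    Y∖Below-closed _   _             (inj₁ t↓x , t↛x) = contradiction t↓x t↛x
    Y∖Below-closed x≢p (fwd-arc s↝t) (inj₂ tt  , t↛x) =
      inj₂ tt , λ t↓y → [ t↛x , (λ x⇾t → x≢p (⇾-parent-unique x⇾t p⇾t)) ]′ (fwd-subtree-entry s↝t t↓y)

  open FinEncoding (↔-trans (Node↔Fin K ⊎-↔ Node↔Fin K) (↔-sym +↔⊎))
  module Dᴱ = EncodedDigraph _⟶?_ ⟶-irrefl
  module Tᴱ = EncodedDigraph _⇾?_ ⇾-irrefl

  D T : Digraph
  D = Dᴱ.digraph
  T = Tᴱ.digraph

  out-degree : MinOutDeg≥ D r
  out-degree v = ≤-trans (n≤1+n r) (Dᴱ.outdeg≥ v (out-successors (decode v)))

  in-degree : MinInDeg≥ D r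
  in-degree v = ≤-trans (n≤1+n r) (Dᴱ.indeg≥ v (in-successors (decode v)))

  two-cycle : HasTwoCycle D
  two-cycle = encode (fwd []) , encode (fwd (zero ∷ [])) ,
              Dᴱ.E⇒Arc (fwd-arc (child ([]⋖ {a = zero}))) ,
              Dᴱ.E⇒Arc (fwd-arc (ancestor ([]≺ {a = zero} {s = []})))

  arborescence : Arborescence
  arborescence = height-arborescence T (encode (fwd [])) (height ∘ decode)
    (λ {i} {j} ij → ⇾-height (Tᴱ.Arc⇒E {i} {j} ij))
    (λ {i} {j} {k} ik jk → decode-injective (⇾-parent-unique (Tᴱ.Arc⇒E {i} {k} ik) (Tᴱ.Arc⇒E {j} {k} jk)))
    (λ t → Equivalence.from Tᴱ.Star⇔ (Equivalence.from ⇾*⇔Below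
             (subst (λ x → Below x (decode t)) (sym (decode∘encode (fwd []))) ([]-Below (decode t)))))

  Subtree : Fin (n T) → Fin (n D) → Set
  Subtree t v = ∃ λ u → Star (Arc T) t u × v ∈ ⁅ u ⁆

  Below⇔Subtree : ∀ t v → Below (decode t) (decode v) ⇔ Subtree t v
  Below⇔Subtree t v = mk⇔ to from
    where
    to : Below (decode t) (decode v) → Subtree t v
    to t↓v = v , Equivalence.from Tᴱ.Star⇔ (Equivalence.from ⇾*⇔Below t↓v) , x∈⁅x⁆ v
    from : Subtree t v → Below (decode t) (decode v)
    from (u , t⇝u , v∈⁅u⁆) with x∈⁅y⁆⇒x≡y u v∈⁅u⁆
    ... | refl = Equivalence.to ⇾*⇔Below (Equivalence.to Tᴱ.Star⇔ t⇝u)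

  lift-closed : ∀ {s} {P : V → Set} →
                (∀ {x y} → x ≢ decode s → y ≢ decode s → x ⟶ y → P x → P y) →
                ClosedIn D ⁅ s ⁆ (P ∘ decode)
  lift-closed P-closed {i} {j} i∉⁅s⁆ j∉⁅s⁆ ij =
    P-closed (decode-≢ i∉⁅s⁆) (decode-≢ j∉⁅s⁆) (Dᴱ.Arc⇒E {i} {j} ij)
    where
    decode-≢ : ∀ {i s} → i ∉ ⁅ s ⁆ → decode i ≢ decode s
    decode-≢ i∉⁅s⁆ = x∉⁅y⁆⇒x≢y i∉⁅s⁆ ∘ decode-injective

  subtree-normal : ∀ {s t} → Arc T s t → IsNormal D ⁅ s ⁆ (Subtree t)
  subtree-normal {s} {t} st =
    IsNormal-resp (Below⇔Subtree t)
      (trapped⇒normal (Y ∘ decode) (Below (decode t) ∘ decode) Below∩⁅s⁆≡∅ inj₁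
        (lift-closed Y-closed) (lift-closed (λ x≢p _ → Y∖Below-closed x≢p)))
    where
    open Trap (Tᴱ.Arc⇒E {s} {t} st)
    Below∩⁅s⁆≡∅ : ∀ v → Below (decode t) (decode v) → v ∉ ⁅ s ⁆
    Below∩⁅s⁆≡∅ v t↓v v∈⁅s⁆ = Below∌parent t↓v (cong decode (x∈⁅y⁆⇒x≡y s v∈⁅s⁆))

  decomposition : ArborealDecomposition D
  decomposition = record
    { R        = arborescence
    ; X        = λ s _ → ⁅ s ⁆
    ; W        = ⁅_⁆
    ; nonempty = λ t → t , x∈⁅x⁆ t
    ; disjoint = λ t u v v∈t v∈u → trans (sym (x∈⁅y⁆⇒x≡y t v∈t)) (x∈⁅y⁆⇒x≡y u v∈u)
    ; covers   = λ v → v , x∈⁅x⁆ v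
    ; normal   = λ _ _ → subtree-normal
    }

  width≤1 : width decomposition ≤ 1
  width≤1 = width≤ decomposition (λ t → ∣p∣≤2 (bag⊆ t))
    where
    bag⊆ : ∀ t {x} → x ∈ bag decomposition t → x ≡ t ⊎ x ≡ encode (parentᵀ (decode t))
    bag⊆ t x∈bag with ∈-bag⁻ decomposition x∈bag
    ... | inj₁ x∈⁅t⁆                   = inj₁ (x∈⁅y⁆⇒x≡y t x∈⁅t⁆)
    ... | inj₂ (_ , inj₂ (_ , x∈⁅t⁆))  = inj₁ (x∈⁅y⁆⇒x≡y t x∈⁅t⁆)
    ... | inj₂ (u , inj₁ (ut , x∈⁅u⁆)) = inj₂ (begin
      _                           ≡⟨ x∈⁅y⁆⇒x≡y u x∈⁅u⁆ ⟩
      u                           ≡⟨ encode∘decode u ⟨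
      encode (decode u)           ≡⟨ cong encode (⇾-parent (Tᴱ.Arc⇒E {u} {t} ut)) ⟩
      encode (parentᵀ (decode t)) ∎)
      where open ≡-Reasoning

mainTheorem4 : ∀ (r : ℕ) → ∃ λ (D : Digraph) → MinOutDeg≥ D r × MinInDeg≥ D r × DTW≡ D 1
mainTheorem4 r = D , out-degree , in-degree , DTW≡1 two-cycle decomposition width≤1
  where open Construction r
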